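{- The following upper bounds hold: (1) $n(a,b,g)\leq n(a,g)\cdot \tilde n\big(b\cdot n(a,g),\lceil g/2\rceil\big)$ for $a\geq 2$, $g\geq 3$; (2) $n(a,b,g)\leq n(b,g/2)\cdot \tilde n\big(a\cdot n(b,g/2),g\big)$ for $b\geq 2$, $g\geq 6$, $g$ even; (3) $n(a,b,g)\leq 2\cdot n(a,g)$ for $a\geq 2$, $b=1$, $g\leq 6$; (4) $n(a,b,g)\leq 2\cdot \tilde n(b,3)$ for $a=1$, $b\geq 1$, $g=6$.
   Context: All parameters are nonnegative integers. A weighted graph (wgraph) is a pair $G=(L,H)$ of simple finite graphs with $V(L)=V(H)$ and $E(L)\cap E(H)=\varnothing$; edges of $L$ are light (weight 1) and edges of $H$ are heavy (weight 2). A wcycle is a cycle (of length at least 3) in the graph with edge set $E(L)\cup E(H)$; its weight is the sum of the weights of its edges. The girth of $G$ is the minimum weight of a wcycle. $G$ is $(a,b)$-regular if $L$ is $a$-regular and $H$ is $b$-regular. An $(a,b,g)$-wgraph is an $(a,b)$-regular wgraph of girth $g$; $n(a,b,g)$ is the minimum order of an $(a,b,g)$-wgraph ($\infty$ if none exists). $n(r,g)$ is the minimum order of an $r$-regular (ordinary) graph of girth $g$ ($\infty$ if none exists). $\tilde n(r,g)=n(r,g)$ if $r\geq 2$ and $g\geq 3$, and $\tilde n(r,g)=r+1$ if $0\leq r\leq 1$ or $g=2$. -}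

module Defs where

open import Data.Nat using (ℕ; zero; suc; _+_; _*_; _≤_)
open import Data.Bool using (Bool; true; false; T; _∨_; if_then_else_)
open import Data.Fin using (Fin)
open import Data.List using (List; []; _∷_; _++_; zip; length; map; allFin)
open import Data.Nat.ListAction using (sum)
open import Data.List.Relation.Unary.All using (All)
open import Data.List.Relation.Unary.Unique.Propositional using (Unique)
open import Data.Product using (Σ; ∃; _×_; _,_; proj₁; proj₂)
open import Data.Sum using (_⊎_)
open import Relation.Binary.PropositionalEquality using (_≡_)

record Graph (n : ℕ) : Set where
  field
    adj    : Fin n → Fin n → Bool
    sym    : ∀ i j → adj i j ≡ adj j i
    irrefl : ∀ i → adj i i ≡ false
open Graph public

degree : ∀ {n} → Graph n → Fin n → ℕ
degree {n} G i = sum (map (λ j → if adj G i j then 1 else 0) (allFin n))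

Regular : ∀ {n} → ℕ → Graph n → Set
Regular r G = ∀ i → degree G i ≡ r

cyclePairs : ∀ {n} → List (Fin n) → List (Fin n × Fin n)
cyclePairs []       = []
cyclePairs (v ∷ vs) = zip (v ∷ vs) (vs ++ v ∷ [])

IsCycle : ∀ {n} → (Fin n → Fin n → Bool) → List (Fin n) → Set
IsCycle adjR vs =
  (3 ≤ length vs) × Unique vs × All (λ p → T (adjR (proj₁ p) (proj₂ p))) (cyclePairs vs)

HasGirth : ∀ {n} → Graph n → ℕ → Set
HasGirth G g =
  (Σ (List _) λ vs → IsCycle (adj G) vs × length vs ≡ g)
  × (∀ vs → IsCycle (adj G) vs → g ≤ length vs)

record WGraph (n : ℕ) : Set where
  field
    L        : Graph n
    H        : Graph n
    disjoint : ∀ i j → adj L i j ≡ true → adj H i j ≡ false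
open WGraph public

wadj : ∀ {n} → WGraph n → Fin n → Fin n → Bool
wadj G i j = adj (L G) i j ∨ adj (H G) i j

edgeWeight : ∀ {n} → WGraph n → Fin n × Fin n → ℕ
edgeWeight G (i , j) =
  if adj (L G) i j then 1 else (if adj (H G) i j then 2 else 0)

cycleWeight : ∀ {n} → WGraph n → List (Fin n) → ℕ
cycleWeight G vs = sum (map (edgeWeight G) (cyclePairs vs))

HasWGirth : ∀ {n} → WGraph n → ℕ → Set
HasWGirth G g =
  (Σ (List _) λ vs → IsCycle (wadj G) vs × cycleWeight G vs ≡ g)
  × (∀ vs → IsCycle (wadj G) vs → g ≤ cycleWeight G vs)

HasGraph : ℕ → ℕ → ℕ → Set
HasGraph r g N = Σ (Graph N) λ G → Regular r G × HasGirth G g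

HasWGraph : ℕ → ℕ → ℕ → ℕ → Set
HasWGraph a b g N =
  Σ (WGraph N) λ G → Regular a (L G) × Regular b (H G) × HasWGirth G g

IsN : ℕ → ℕ → ℕ → Set
IsN r g N = HasGraph r g N × (∀ m → HasGraph r g m → N ≤ m)

IsNtilde : ℕ → ℕ → ℕ → Set
IsNtilde r g N = ((r ≤ 1 ⊎ g ≡ 2) × N ≡ suc r) ⊎ ((2 ≤ r × 3 ≤ g) × IsN r g N)

NWLe : ℕ → ℕ → ℕ → ℕ → Set
NWLe a b g X = ∃ λ m → m ≤ X × HasWGraph a b g m

{-# OPTIONS --safe #-}
-- Every bound is realised by a layered wgraph: one copy of a graph G for each vertex of a graph K
-- (the layers), together with edges between layers that follow K; one of the two kinds of edges
-- is light and the other heavy.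
--
-- For (1) and (2) a vertex of K of degree c · N deals its neighbours out to its N copies, c to each,
-- so every copy gets c edges between layers and two layers are joined by at most one edge. A wcycle
-- inside one layer is a cycle of G. A wcycle leaving its layer, once its steps inside layers are
-- contracted, becomes a closed walk in K that never turns back (it could only do so along the edge
-- it just used), and such a walk contains a cycle of K no longer than the number of crossings. So
-- every wcycle weighs at least the girth of G times the weight of edges inside layers, or the girth
-- of K times the weight of edges between layers.
--
-- For (3) and (4) K is a single edge and the two layers are joined by the perfect matching
-- (u , 0) — (u , 1). A wcycle leaving its layer has to come back, never crosses twice in a row and
-- cannot be a triangle; so it has at least four vertices, at least two crossings and at least two
-- steps inside layers, and weighs at least 6.
module Submission where

open import Defs hiding (sym)

open import Data.Bool using (Bool; true; false; T; _∧_; _∨_; not; if_then_else_)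
open import Data.Bool.Properties using (∧-zeroʳ; ∧-assoc; ∧-comm; T-≡; T-∧; T-∨)
open import Data.Fin.Patterns using (0F; 1F; 2F; 3F)
open import Data.Fin as F using (Fin; zero; suc; toℕ; combine; remQuot; _↑ˡ_; _↑ʳ_)
open import Data.Fin.Properties using (¬Fin0; remQuot-combine; combine-remQuot; combine-injectiveˡ; toℕ<n; toℕ-injective)
open import Data.List using (List; []; _∷_; _++_; map; allFin; tabulate; zip; length)
open import Data.Nat using (⌈_/2⌉; ⌊_/2⌋; ℕ; zero; suc; _+_; _*_; _≤_; _<_; _≥_; z≤n; s≤s; s≤s⁻¹; z<s; _≡ᵇ_; _%_; NonZero)
open import Data.Nat.Divisibility using (_∣_; divides)
open import Data.Nat.DivMod using (m%n<n; [m+n]%n≡m%n; m<n⇒m%n≡m)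
open import Data.Nat.ListAction using (sum)
open import Data.Nat.Properties
open import Algebra.Properties.CommutativeMonoid.Sum +-0-commutativeMonoid
  using (sum-syntax; sum-cong-≗; sum-replicate-zero; ∑-comm) renaming (sum to ∑)
open import Algebra.Properties.Semiring.Sum +-*-semiring using (*-distribˡ-sum; *-distribʳ-sum)
open import Data.Product using (∃; _×_; _,_; proj₁; proj₂)
open import Data.List.Properties using (map-tabulate; ++-assoc; ∷ʳ-injective; ∷-injective; ∷-injectiveˡ; ∷-injectiveʳ; length-map; length-++; map-++)
open import Data.List.Membership.Propositional using (_∈_; _∉_)
open import Data.List.Membership.Propositional.Properties using (∈-++⁺ʳ; ∈-∃++)
import Data.List.Membership.DecPropositional as DecMembership
open import Data.List.Relation.Unary.All as All using (All; []; _∷_)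
import Data.List.Relation.Unary.All.Properties as All
open import Data.List.Relation.Unary.Any using (here; there)
open import Data.List.Relation.Unary.AllPairs using ([]; _∷_)
open import Data.List.Relation.Unary.Unique.Propositional using (Unique)
import Data.List.Relation.Unary.Unique.Propositional.Properties as Unique
open import Data.Sum using (_⊎_; inj₁; inj₂; [_,_]′)
open import Data.Empty using (⊥; ⊥-elim)
open import Data.Nat.Solver using (module +-*-Solver)
open import Function using (_∘_; id; Equivalence)
open import Relation.Binary.PropositionalEquality
open import Relation.Nullary using (¬_; yes; no; does; contradiction)
open import Relation.Nullary.Decidable using (dec-true; dec-false)

-- Indicators, finite sums and counting

𝟙 : Bool → ℕ
𝟙 b = if b then 1 else 0

𝟙-∧ : ∀ x y → 𝟙 (x ∧ y) ≡ 𝟙 x * 𝟙 y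
𝟙-∧ true  y = sym (+-identityʳ (𝟙 y))
𝟙-∧ false y = refl

_==_ : ∀ {n} → Fin n → Fin n → Bool
i == j = does (i F.≟ j)

==-refl : ∀ {n} (i : Fin n) → (i == i) ≡ true
==-refl i = dec-true (i F.≟ i) refl

==-false : ∀ {n} {i j : Fin n} → i ≢ j → (i == j) ≡ false
==-false {i = i} {j} = dec-false (i F.≟ j)

==-sym : ∀ {n} (i j : Fin n) → (i == j) ≡ (j == i)
==-sym i j with i F.≟ j | j F.≟ i
... | yes _   | yes _   = refl
... | no  _   | no  _   = refl
... | yes i≡j | no  j≢i = contradiction (sym i≡j) j≢i
... | no  i≢j | yes j≡i = contradiction (sym j≡i) i≢j

==⇒≡ : ∀ {n} {i j : Fin n} → T (i == j) → i ≡ j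
==⇒≡ {i = i} {j} t with i F.≟ j
... | yes i≡j = i≡j

T-∨-resolveˡ : ∀ {x y} → T (x ∨ y) → x ≡ false → T y
T-∨-resolveˡ t refl = t

T-∨-resolveʳ : ∀ {x y} → T (x ∨ y) → y ≡ false → T x
T-∨-resolveʳ {true}  t _ = t
T-∨-resolveʳ {false} t refl = t

≡ᵇ-refl : ∀ m → (m ≡ᵇ m) ≡ true
≡ᵇ-refl m = dec-true (m ≟ m) refl

≡ᵇ-false : ∀ {m n} → m ≢ n → (m ≡ᵇ n) ≡ false
≡ᵇ-false {m} {n} = dec-false (m ≟ n)

sum-map-allFin : ∀ {n} (f : Fin n → ℕ) → sum (map f (allFin n)) ≡ ∑ f
sum-map-allFin {n} f = trans (cong sum (map-tabulate id f)) (sum-tabulate f)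
  where
  sum-tabulate : ∀ {n} (h : Fin n → ℕ) → sum (tabulate h) ≡ ∑ h
  sum-tabulate {zero}  h = refl
  sum-tabulate {suc n} h = cong (h zero +_) (sum-tabulate (h ∘ suc))

∑-combine : ∀ {n k} (f : Fin (n * k) → ℕ) → ∑ f ≡ ∑[ i < n ] ∑[ j < k ] f (combine i j)
∑-combine {zero}      f = refl
∑-combine {suc n} {k} f =
  trans (∑-↑ {k} {n * k} f) (cong (∑ (f ∘ (_↑ˡ n * k)) +_) (∑-combine {n} (f ∘ (k ↑ʳ_))))
  where
  ∑-↑ : ∀ {a b} (h : Fin (a + b) → ℕ) → ∑ h ≡ ∑ (h ∘ (_↑ˡ b)) + ∑ (h ∘ (a ↑ʳ_))
  ∑-↑ {zero}  h = refl
  ∑-↑ {suc a} h = trans (cong (h zero +_) (∑-↑ {a} (h ∘ suc))) (sym (+-assoc (h zero) _ _))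

∑-𝟙-== : ∀ {n} (i : Fin n) → ∑[ j < n ] 𝟙 (i == j) ≡ 1
∑-𝟙-== {suc n} zero    = cong suc (sum-replicate-zero n)
∑-𝟙-== {suc n} (suc i) = ∑-𝟙-== i

∑-𝟙-toℕ≡ᵇ : ∀ {n} q → q < n → ∑[ i < n ] 𝟙 (toℕ i ≡ᵇ q) ≡ 1
∑-𝟙-toℕ≡ᵇ {suc n} zero    _         = cong suc (sum-replicate-zero n)
∑-𝟙-toℕ≡ᵇ {suc n} (suc q) (s≤s q<n) = ∑-𝟙-toℕ≡ᵇ q q<n

∑-𝟙-not+∑-𝟙 : ∀ {n} (f : Fin n → Bool) → ∑ (𝟙 ∘ not ∘ f) + ∑ (𝟙 ∘ f) ≡ n
∑-𝟙-not+∑-𝟙 {zero}  f = refl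
∑-𝟙-not+∑-𝟙 {suc n} f with f zero
... | true  = trans (+-suc _ _) (cong suc (∑-𝟙-not+∑-𝟙 (f ∘ suc)))
... | false = cong suc (∑-𝟙-not+∑-𝟙 (f ∘ suc))

countFrom : (ℕ → Bool) → ℕ → ℕ → ℕ
countFrom P o zero    = 0
countFrom P o (suc n) = 𝟙 (P o) + countFrom P (suc o) n

countFrom-+ : ∀ P o m n → countFrom P o (m + n) ≡ countFrom P o m + countFrom P (o + m) n
countFrom-+ P o zero    n = cong (λ o′ → countFrom P o′ n) (sym (+-identityʳ o))
countFrom-+ P o (suc m) n = begin
  𝟙 (P o) + countFrom P (suc o) (m + n)
    ≡⟨ cong (𝟙 (P o) +_) (countFrom-+ P (suc o) m n) ⟩
  𝟙 (P o) + (countFrom P (suc o) m + countFrom P (suc o + m) n)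
    ≡⟨ sym (+-assoc (𝟙 (P o)) _ _) ⟩
  countFrom P o (suc m) + countFrom P (suc o + m) n
    ≡⟨ cong (λ o′ → countFrom P o (suc m) + countFrom P o′ n) (sym (+-suc o m)) ⟩
  countFrom P o (suc m) + countFrom P (o + suc m) n ∎
  where open ≡-Reasoning

countFrom-periodic : ∀ P N → (∀ r → P (r + N) ≡ P r) → ∀ o n → countFrom P (o + N) n ≡ countFrom P o n
countFrom-periodic P N per o zero    = refl
countFrom-periodic P N per o (suc n) = cong₂ _+_ (cong 𝟙 (per o)) (countFrom-periodic P N per (suc o) n)

countFrom-*-period : ∀ P N → (∀ r → P (r + N) ≡ P r) → ∀ b → countFrom P 0 (b * N) ≡ b * countFrom P 0 N
countFrom-*-period P N per zero    = refl
countFrom-*-period P N per (suc b) =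
  trans (countFrom-+ P 0 N (b * N))
        (cong (countFrom P 0 N +_) (trans (countFrom-periodic P N per 0 (b * N)) (countFrom-*-period P N per b)))

countFrom-cong : ∀ P Q o n → (∀ r → o ≤ r → r < o + n → P r ≡ Q r) → countFrom P o n ≡ countFrom Q o n
countFrom-cong P Q o zero    P≗Q = refl
countFrom-cong P Q o (suc n) P≗Q =
  cong₂ _+_ (cong 𝟙 (P≗Q o ≤-refl (≤-trans (s≤s (m≤m+n o n)) (≤-reflexive (sym (+-suc o n))))))
            (countFrom-cong P Q (suc o) n (λ r o<r r<o+n →
               P≗Q r (≤-trans (n≤1+n o) o<r) (≤-trans r<o+n (≤-reflexive (sym (+-suc o n))))))

countFrom-≡ᵇ-below : ∀ q o n → q < o → countFrom (q ≡ᵇ_) o n ≡ 0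
countFrom-≡ᵇ-below q o zero    q<o = refl
countFrom-≡ᵇ-below q o (suc n) q<o =
  cong₂ _+_ (cong 𝟙 (≡ᵇ-false (<⇒≢ q<o))) (countFrom-≡ᵇ-below q (suc o) n (m<n⇒m<1+n q<o))

countFrom-≡ᵇ-within : ∀ q o n → o ≤ q → q < o + n → countFrom (q ≡ᵇ_) o n ≡ 1
countFrom-≡ᵇ-within q o zero    o≤q q<o+0 = contradiction (≤-trans (≤-reflexive (+-identityʳ o)) o≤q) (<⇒≱ q<o+0)
countFrom-≡ᵇ-within q o (suc n) o≤q q<o+n with q ≟ o
... | yes refl = cong₂ _+_ (cong 𝟙 (≡ᵇ-refl q)) (countFrom-≡ᵇ-below q (suc q) n ≤-refl)
... | no  q≢o  = cong₂ _+_ (cong 𝟙 (≡ᵇ-false q≢o))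
  (countFrom-≡ᵇ-within q (suc o) n (≤∧≢⇒< o≤q (q≢o ∘ sym)) (≤-trans q<o+n (≤-reflexive (+-suc o n))))

countFrom-residue : ∀ N .{{_ : NonZero N}} b q → q < N → countFrom (λ r → q ≡ᵇ r % N) 0 (b * N) ≡ b
countFrom-residue N b q q<N = begin
  countFrom P 0 (b * N)  ≡⟨ countFrom-*-period P N (λ r → cong (q ≡ᵇ_) ([m+n]%n≡m%n r N)) b ⟩
  b * countFrom P 0 N    ≡⟨ cong (b *_) (countFrom-cong P (q ≡ᵇ_) 0 N (λ r _ r<N → cong (q ≡ᵇ_) (m<n⇒m%n≡m r<N))) ⟩
  b * countFrom (q ≡ᵇ_) 0 N  ≡⟨ cong (b *_) (countFrom-≡ᵇ-within q 0 N z≤n q<N) ⟩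
  b * 1                  ≡⟨ *-identityʳ b ⟩
  b                      ∎
  where
  open ≡-Reasoning
  P = λ r → q ≡ᵇ r % N

rank : ∀ {M} → (Fin M → Bool) → Fin M → ℕ
rank f zero    = 0
rank f (suc i) = 𝟙 (f zero) + rank (f ∘ suc) i

∑-rank : ∀ {M} (f : Fin M → Bool) (P : ℕ → Bool) o →
  ∑[ i < M ] 𝟙 (f i ∧ P (o + rank f i)) ≡ countFrom P o (∑ (𝟙 ∘ f))
∑-rank {zero}  f P o = refl
∑-rank {suc M} f P o with f zero
... | true  = cong₂ _+_ (cong (𝟙 ∘ P) (+-identityʳ o))
  (trans (sum-cong-≗ (λ i → cong (λ r → 𝟙 (f (suc i) ∧ P r)) (+-suc o (rank (f ∘ suc) i))))
         (∑-rank (f ∘ suc) P (suc o)))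
... | false = ∑-rank (f ∘ suc) P o

-- Walks and cycles as lists

module _ {A : Set} where

  pairs : List A → List (A × A)
  pairs []          = []
  pairs (x ∷ [])    = []
  pairs (x ∷ y ∷ r) = (x , y) ∷ pairs (y ∷ r)

  close : List A → List A
  close []       = []
  close (v ∷ vs) = v ∷ vs ++ v ∷ []

  zip-∷ʳ≡pairs : ∀ (x : A) xs y → zip (x ∷ xs) (xs ++ y ∷ []) ≡ pairs (x ∷ xs ++ y ∷ [])
  zip-∷ʳ≡pairs x []       y = refl
  zip-∷ʳ≡pairs x (z ∷ zs) y = cong ((x , z) ∷_) (zip-∷ʳ≡pairs z zs y)

  Walk : (A → A → Bool) → List A → Set
  Walk R xs = All (λ p → T (R (proj₁ p) (proj₂ p))) (pairs xs)

  Walk-tail : ∀ {R} x xs → Walk R (x ∷ xs) → Walk R xs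
  Walk-tail x []      w       = []
  Walk-tail x (y ∷ _) (_ ∷ w) = w

  Walk-++ˡ : ∀ {R} xs ys → Walk R (xs ++ ys) → Walk R xs
  Walk-++ˡ []           ys w       = []
  Walk-++ˡ (x ∷ [])     ys w       = []
  Walk-++ˡ (x ∷ y ∷ xs) ys (r ∷ w) = r ∷ Walk-++ˡ (y ∷ xs) ys w

  Walk-++ʳ : ∀ {R} xs ys → Walk R (xs ++ ys) → Walk R ys
  Walk-++ʳ []       ys w = w
  Walk-++ʳ (x ∷ xs) ys w = Walk-++ʳ xs ys (Walk-tail x (xs ++ ys) w)

  Walk-step : ∀ {R} xs a b ys → Walk R (xs ++ a ∷ b ∷ ys) → T (R a b)
  Walk-step xs a b ys w with Walk-++ʳ xs (a ∷ b ∷ ys) w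
  ... | r ∷ _ = r

  Unique-++ˡ : ∀ (xs : List A) {ys} → Unique (xs ++ ys) → Unique xs
  Unique-++ˡ []       u        = []
  Unique-++ˡ (x ∷ xs) (x∉ ∷ u) = All.++⁻ˡ xs x∉ ∷ Unique-++ˡ xs u

  Unique-++ʳ : ∀ (xs : List A) {ys} → Unique (xs ++ ys) → Unique ys
  Unique-++ʳ []       u       = u
  Unique-++ʳ (x ∷ xs) (_ ∷ u) = Unique-++ʳ xs u

  Unique⇒∉-after : ∀ xs (a : A) ys → Unique (xs ++ a ∷ ys) → a ∉ ys
  Unique⇒∉-after xs a ys u a∈ys with Unique-++ʳ xs u
  ... | a∉ ∷ _ = All.lookup a∉ a∈ys refl

  Unique⇒≢-before : ∀ xs (a : A) ys → Unique (xs ++ a ∷ ys) → All (a ≢_) xs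
  Unique⇒≢-before []       a ys u        = []
  Unique⇒≢-before (x ∷ xs) a ys (x∉ ∷ u) =
    (λ a≡x → All.lookup x∉ (∈-++⁺ʳ xs (here refl)) (sym a≡x)) ∷ Unique⇒≢-before xs a ys u

  Unique-head≢last : ∀ (xs : List A) x t ys → Unique xs → xs ≡ x ∷ t → xs ≡ ys ++ x ∷ [] → 2 ≤ length xs → ⊥
  Unique-head≢last xs x t []       u refl refl (s≤s ())
  Unique-head≢last xs x t (y ∷ ys) u refl eq _    with u
  ... | x∉ ∷ _ = All.lookup x∉ (subst (x ∈_) (sym (∷-injectiveʳ eq)) (∈-++⁺ʳ ys (here refl))) refl

  length-<-++∷ : ∀ (xs : List A) y ys → length xs < length (xs ++ y ∷ ys)
  length-<-++∷ xs y ys = subst (length xs <_) (sym (length-++ xs)) (m<m+n (length xs) z<s)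

  NonBacktracking : List A → Set
  NonBacktracking W = ∀ xs x y ys → W ≢ xs ++ x ∷ y ∷ x ∷ ys

  NonBacktracking-tail : ∀ y W → NonBacktracking (y ∷ W) → NonBacktracking W
  NonBacktracking-tail y W nb xs x z ys eq = nb (y ∷ xs) x z ys (cong (y ∷_) eq)

  ∷ʳ≡⇒prefix : ∀ (xs : List A) v ys y z zs → xs ++ v ∷ [] ≡ ys ++ y ∷ z ∷ zs → ∃ λ zs′ → xs ≡ ys ++ y ∷ zs′
  ∷ʳ≡⇒prefix []       v []          y z zs ()
  ∷ʳ≡⇒prefix (x ∷ xs) v []          y z zs eq = xs , cong (_∷ xs) (∷-injectiveˡ eq)
  ∷ʳ≡⇒prefix []       v (w ∷ [])    y z zs ()
  ∷ʳ≡⇒prefix []       v (w ∷ _ ∷ _) y z zs ()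
  ∷ʳ≡⇒prefix (x ∷ xs) v (w ∷ ys)    y z zs eq with ∷ʳ≡⇒prefix xs v ys y z zs (∷-injectiveʳ eq)
  ... | zs′ , e = zs′ , cong₂ _∷_ (∷-injectiveˡ eq) e

  close-no-reversal : ∀ (v : A) vs → Unique (v ∷ vs) → 2 ≤ length vs → ∀ xs a b ys zs ws →
    close (v ∷ vs) ≡ xs ++ a ∷ b ∷ ys → b ∷ ys ≢ zs ++ b ∷ a ∷ ws
  close-no-reversal v vs u _   xs a b ys [] (w ∷ ws) e refl
    with ∷ʳ≡⇒prefix (v ∷ vs) v (xs ++ a ∷ b ∷ []) a w ws (trans e (sym (++-assoc xs (a ∷ b ∷ []) (a ∷ w ∷ ws))))
  ... | ws′ , e′ = Unique⇒∉-after xs a (b ∷ a ∷ ws′)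
                     (subst Unique (trans e′ (++-assoc xs (a ∷ b ∷ []) (a ∷ ws′))) u) (there (here refl))
  close-no-reversal v vs u _   xs a b ys [] [] e refl
    with ∷ʳ-injective (v ∷ vs) (xs ++ a ∷ b ∷ []) (trans e (sym (++-assoc xs (a ∷ b ∷ []) (a ∷ []))))
  close-no-reversal v vs u (s≤s ()) [] a b ys [] [] e refl | refl , refl
  close-no-reversal v vs u _   (x ∷ xs) a b ys [] [] e refl | e′ , refl =
    Unique⇒∉-after [] a (xs ++ a ∷ b ∷ [])
      (subst Unique (trans e′ (cong (λ z → z ∷ xs ++ a ∷ b ∷ []) (sym (∷-injectiveˡ e)))) u) (∈-++⁺ʳ xs (here refl))
  close-no-reversal v vs u _   xs a b ys (z ∷ zs) ws e e₂ with ∷-injective e₂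
  ... | refl , refl
    with ∷ʳ≡⇒prefix (v ∷ vs) v (xs ++ a ∷ b ∷ zs) b a ws (trans e (sym (++-assoc xs (a ∷ b ∷ zs) (b ∷ a ∷ ws))))
  ... | ws′ , e′ = Unique⇒∉-after (xs ++ a ∷ []) b (zs ++ b ∷ ws′)
        (subst Unique (trans e′ (trans (++-assoc xs (a ∷ b ∷ zs) (b ∷ ws′)) (sym (++-assoc xs (a ∷ []) (b ∷ zs ++ b ∷ ws′))))) u)
        (∈-++⁺ʳ zs (here refl))

  close-nonBacktracking : ∀ (v : A) vs → Unique (v ∷ vs) → 2 ≤ length vs → NonBacktracking (close (v ∷ vs))
  close-nonBacktracking v vs u 2≤∣vs∣ xs x y ys e = close-no-reversal v vs u 2≤∣vs∣ xs x y (x ∷ ys) [] ys e refl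

  ∷ʳ≡∷ : ∀ xs (v : A) → ∃ λ y → ∃ λ ys → xs ++ v ∷ [] ≡ y ∷ ys
  ∷ʳ≡∷ []       v = v , [] , refl
  ∷ʳ≡∷ (x ∷ xs) v = x , xs ++ v ∷ [] , refl

cyclePairs≡pairs∘close : ∀ {n} (vs : List (Fin n)) → cyclePairs vs ≡ pairs (close vs)
cyclePairs≡pairs∘close []       = refl
cyclePairs≡pairs∘close (v ∷ vs) = zip-∷ʳ≡pairs v vs v

module _ {M : ℕ} (R : Fin M → Fin M → Bool) (R-irrefl : ∀ i → R i i ≡ false) where
  open DecMembership (F._≟_ {M}) using (_∈?_)

  -- The first repeated vertex closes a cycle, of length at least 3 since R is irreflexive and W does not backtrack.
  nonBacktracking⇒Unique⊎cycle : ∀ W → Walk R W → NonBacktracking W →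
    Unique W ⊎ (∃ λ cs → IsCycle R cs × length cs < length W)
  nonBacktracking⇒Unique⊎cycle []      w nb = inj₁ []
  nonBacktracking⇒Unique⊎cycle (y ∷ W) w nb
    with nonBacktracking⇒Unique⊎cycle W (Walk-tail y W w) (NonBacktracking-tail y W nb)
  ... | inj₂ (cs , c , lt) = inj₂ (cs , c , m<n⇒m<1+n lt)
  ... | inj₁ u with y ∈? W
  ... | no y∉W = inj₁ (All.¬Any⇒All¬ W y∉W ∷ u)
  ... | yes y∈W with ∈-∃++ y∈W
  nonBacktracking⇒Unique⊎cycle (y ∷ W) (r ∷ w) nb | inj₁ u | yes _ | [] , s , refl =
    ⊥-elim (subst T (R-irrefl y) r)
  nonBacktracking⇒Unique⊎cycle (y ∷ W) w nb | inj₁ u | yes _ | z ∷ [] , s , refl =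
    contradiction refl (nb [] y z s)
  nonBacktracking⇒Unique⊎cycle (y ∷ W) w nb | inj₁ u | yes _ | z ∷ z′ ∷ r , s , refl =
    inj₂ (y ∷ z ∷ z′ ∷ r ,
          (s≤s (s≤s (s≤s z≤n)) ,
           Unique⇒≢-before (z ∷ z′ ∷ r) y s u ∷ Unique-++ˡ (z ∷ z′ ∷ r) u ,
           subst (All _) (sym (cyclePairs≡pairs∘close (y ∷ z ∷ z′ ∷ r)))
             (Walk-++ˡ (close (y ∷ z ∷ z′ ∷ r)) s
               (subst (Walk R) (cong (y ∷_) (sym (++-assoc (z ∷ z′ ∷ r) (y ∷ []) s))) w))) ,
          s≤s (length-<-++∷ (z ∷ z′ ∷ r) y s))

count : ∀ {A : Set} → (A → Bool) → List A → ℕ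
count c []       = 0
count c (x ∷ xs) = 𝟙 (c x) + count c xs

count-not+count : ∀ {A : Set} (c : A → Bool) xs → count (not ∘ c) xs + count c xs ≡ length xs
count-not+count c []       = refl
count-not+count c (x ∷ xs) with c x
... | true  = trans (+-suc _ _) (cong suc (count-not+count c xs))
... | false = cong suc (count-not+count c xs)

length-pairs : ∀ {A : Set} (x : A) xs → length (pairs (x ∷ xs)) ≡ length xs
length-pairs x []       = refl
length-pairs x (y ∷ xs) = cong suc (length-pairs y xs)

length-cyclePairs : ∀ {n} (vs : List (Fin n)) → length (cyclePairs vs) ≡ length vs
length-cyclePairs []       = refl
length-cyclePairs (v ∷ vs) = begin
  length (cyclePairs (v ∷ vs))     ≡⟨ cong length (cyclePairs≡pairs∘close (v ∷ vs)) ⟩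
  length (pairs (close (v ∷ vs)))  ≡⟨ length-pairs v (vs ++ v ∷ []) ⟩
  length (vs ++ v ∷ [])            ≡⟨ length-++ vs ⟩
  length vs + 1                    ≡⟨ +-comm (length vs) 1 ⟩
  length (v ∷ vs)                  ∎
  where open ≡-Reasoning

pairs-map : ∀ {A B : Set} (f : A → B) xs → pairs (map f xs) ≡ map (λ p → f (proj₁ p) , f (proj₂ p)) (pairs xs)
pairs-map f []           = refl
pairs-map f (x ∷ [])     = refl
pairs-map f (x ∷ y ∷ xs) = cong ((f x , f y) ∷_) (pairs-map f (y ∷ xs))

cyclePairs-map : ∀ {n m} (f : Fin n → Fin m) vs →
  cyclePairs (map f vs) ≡ map (λ p → f (proj₁ p) , f (proj₂ p)) (cyclePairs vs)
cyclePairs-map f []       = refl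
cyclePairs-map f (v ∷ vs) = begin
  cyclePairs (map f (v ∷ vs))                ≡⟨ cyclePairs≡pairs∘close (map f (v ∷ vs)) ⟩
  pairs (f v ∷ map f vs ++ f v ∷ [])          ≡⟨ cong (λ ws → pairs (f v ∷ ws)) (sym (map-++ f vs (v ∷ []))) ⟩
  pairs (map f (close (v ∷ vs)))              ≡⟨ pairs-map f (close (v ∷ vs)) ⟩
  map _ (pairs (close (v ∷ vs)))              ≡⟨ cong (map _) (sym (cyclePairs≡pairs∘close (v ∷ vs))) ⟩
  map _ (cyclePairs (v ∷ vs))                 ∎
  where open ≡-Reasoning

sum-map-const : ∀ {A : Set} (f : A → ℕ) c ps → All (λ p → f p ≡ c) ps → sum (map f ps) ≡ c * length ps
sum-map-const f c []       []       = sym (*-zeroʳ c)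
sum-map-const f c (p ∷ ps) (e ∷ es) = trans (cong₂ _+_ e (sum-map-const f c ps es)) (sym (*-suc c (length ps)))

sum-map-if : ∀ {A : Set} (f : A → ℕ) (c : A → Bool) w₀ w₁ ps →
  All (λ p → f p ≡ (if c p then w₁ else w₀)) ps →
  sum (map f ps) ≡ w₀ * count (not ∘ c) ps + w₁ * count c ps
sum-map-if f c w₀ w₁ []       []       = cong₂ _+_ (sym (*-zeroʳ w₀)) (sym (*-zeroʳ w₁))
sum-map-if f c w₀ w₁ (p ∷ ps) (e ∷ es) = trans (cong₂ _+_ e (sum-map-if f c w₀ w₁ ps es)) (regroup (c p))
  where
  open +-*-Solver
  X = count (not ∘ c) ps
  Y = count c ps
  regroup : ∀ b → (if b then w₁ else w₀) + (w₀ * X + w₁ * Y) ≡ w₀ * (𝟙 (not b) + X) + w₁ * (𝟙 b + Y)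
  regroup true  = solve 4 (λ w₀ w₁ X Y → w₁ :+ (w₀ :* X :+ w₁ :* Y) := w₀ :* X :+ w₁ :* (con 1 :+ Y)) refl w₀ w₁ X Y
  regroup false = solve 4 (λ w₀ w₁ X Y → w₀ :+ (w₀ :* X :+ w₁ :* Y) := w₀ :* (con 1 :+ X) :+ w₁ :* Y) refl w₀ w₁ X Y

module Compress {n M : ℕ} (π : Fin n → Fin M) where

  compress : List (Fin n) → List (Fin M)
  compress []          = []
  compress (x ∷ [])    = π x ∷ []
  compress (x ∷ y ∷ r) = if π x == π y then compress (y ∷ r) else π x ∷ compress (y ∷ r)

  crosses : Fin n × Fin n → Bool
  crosses p = not (π (proj₁ p) == π (proj₂ p))

  compress-head : ∀ x r → ∃ λ t → compress (x ∷ r) ≡ π x ∷ t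
  compress-head x []      = [] , refl
  compress-head x (y ∷ r) with π x F.≟ π y
  ... | no  _  = compress (y ∷ r) , refl
  ... | yes πx≡πy with compress-head y r
  ... | t , eq = t , trans eq (cong (_∷ t) (sym πx≡πy))

  compress-last : ∀ xs y → ∃ λ ws → compress (xs ++ y ∷ []) ≡ ws ++ π y ∷ []
  compress-last []           y = [] , refl
  compress-last (x ∷ [])     y with π x F.≟ π y
  ... | yes _ = [] , refl
  ... | no  _ = π x ∷ [] , refl
  compress-last (x ∷ z ∷ xs) y with π x F.≟ π z | compress-last (z ∷ xs) y
  ... | yes _ | ws , e = ws , e
  ... | no  _ | ws , e = π x ∷ ws , cong (π x ∷_) e

  length-compress : ∀ x r → length (compress (x ∷ r)) ≡ suc (count crosses (pairs (x ∷ r)))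
  length-compress x []      = refl
  length-compress x (y ∷ r) with π x F.≟ π y
  ... | yes _ = length-compress y r
  ... | no  _ = cong suc (length-compress y r)

  compress-walk : ∀ {RV : Fin n → Fin n → Bool} {RK : Fin M → Fin M → Bool} →
    (∀ a b → T (RV a b) → π a ≢ π b → T (RK (π a) (π b))) →
    ∀ xs → Walk RV xs → Walk RK (compress xs)
  compress-walk across-edge []          w       = []
  compress-walk across-edge (x ∷ [])    w       = []
  compress-walk {RK = RK} across-edge (x ∷ y ∷ r) (e ∷ w) with π x F.≟ π y | compress-head y r
  ... | yes _     | _      = compress-walk across-edge (y ∷ r) w
  ... | no πx≢πy | t , eq = subst (λ ws → Walk RK (π x ∷ ws)) (sym eq)
                               (across-edge x y e πx≢πy ∷ subst (Walk RK) eq (compress-walk across-edge (y ∷ r) w))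

  record Crossing (xs : List (Fin n)) (k k′ : Fin M) (C : List (Fin M)) : Set where
    constructor crossing
    field
      before  : List (Fin n)
      a b     : Fin n
      after   : List (Fin n)
      split   : xs ≡ before ++ a ∷ b ∷ after
      π-a     : π a ≡ k
      π-b     : π b ≡ k′
      π-a≢π-b : π a ≢ π b
      rest    : compress (b ∷ after) ≡ k′ ∷ C

  compress-∷∷ : ∀ x y r → (π x ≡ π y × compress (x ∷ y ∷ r) ≡ compress (y ∷ r))
                        ⊎ (π x ≢ π y × compress (x ∷ y ∷ r) ≡ π x ∷ compress (y ∷ r))
  compress-∷∷ x y r with π x F.≟ π y
  ... | yes πx≡πy = inj₁ (πx≡πy , refl)
  ... | no  πx≢πy = inj₂ (πx≢πy , refl)

  Crossing-∷ : ∀ x {xs k k′ C} → Crossing xs k k′ C → Crossing (x ∷ xs) k k′ C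
  Crossing-∷ x (crossing P a b Q s πa πb πa≢πb c) = crossing (x ∷ P) a b Q (cong (x ∷_) s) πa πb πa≢πb c

  compress-step : ∀ xs ks k k′ C → compress xs ≡ ks ++ k ∷ k′ ∷ C → Crossing xs k k′ C
  compress-step []          []          k k′ C ()
  compress-step []          (_ ∷ _)     k k′ C ()
  compress-step (x ∷ [])    []          k k′ C ()
  compress-step (x ∷ [])    (_ ∷ [])    k k′ C ()
  compress-step (x ∷ [])    (_ ∷ _ ∷ _) k k′ C ()
  -- Splitting on compress-∷∷ instead of using `with` keeps the recursion on y ∷ r visibly structural.
  compress-step (x ∷ y ∷ r) ks          k k′ C eq =
    [ (λ (_ , e) → Crossing-∷ x (compress-step (y ∷ r) ks k k′ C (trans (sym e) eq)))
    , (λ (πx≢πy , e) → crossAt ks πx≢πy (trans (sym e) eq)) ]′ (compress-∷∷ x y r)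
    where
    crossAt : ∀ ks → π x ≢ π y → π x ∷ compress (y ∷ r) ≡ ks ++ k ∷ k′ ∷ C → Crossing (x ∷ y ∷ r) k k′ C
    crossAt []       πx≢πy eq = crossing [] x y r refl (∷-injectiveˡ eq)
      (∷-injectiveˡ (trans (sym (proj₂ (compress-head y r))) (∷-injectiveʳ eq))) πx≢πy (∷-injectiveʳ eq)
    crossAt (_ ∷ ks) _     eq = Crossing-∷ x (compress-step (y ∷ r) ks k k′ C (∷-injectiveʳ eq))

  count-crosses≡0⇒All : ∀ ps → count crosses ps ≡ 0 → All (λ p → π (proj₁ p) ≡ π (proj₂ p)) ps
  count-crosses≡0⇒All []             e = []
  count-crosses≡0⇒All ((a , b) ∷ ps) e with π a F.≟ π b
  ... | yes πa≡πb = πa≡πb ∷ count-crosses≡0⇒All ps e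

  count-crosses≡0⇒sameLayer : ∀ x r → count crosses (pairs (x ∷ r)) ≡ 0 → All (λ z → π z ≡ π x) (x ∷ r)
  count-crosses≡0⇒sameLayer x []      e = refl ∷ []
  count-crosses≡0⇒sameLayer x (y ∷ r) e with π x F.≟ π y
  ... | yes πx≡πy = refl ∷ All.map (λ q → trans q (sym πx≡πy)) (count-crosses≡0⇒sameLayer y r e)

  count-crosses≡1⇒endpoints : ∀ x r y → count crosses (pairs (x ∷ r ++ y ∷ [])) ≡ 1 → π x ≢ π y
  count-crosses≡1⇒endpoints x []      y e with π x F.≟ π y
  ... | no πx≢πy = πx≢πy
  count-crosses≡1⇒endpoints x (z ∷ r) y e with π x F.≟ π z
  ... | yes πx≡πz = λ πx≡πy → count-crosses≡1⇒endpoints z r y e (trans (sym πx≡πz) πx≡πy)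
  ... | no  πx≢πz = λ πx≡πy → πx≢πz (trans πx≡πy
        (All.lookup (count-crosses≡0⇒sameLayer z (r ++ y ∷ []) (suc-injective e)) (there (∈-++⁺ʳ r (here refl)))))

-- Layered wgraphs

map-IsCycle : ∀ {n m} {R : Fin n → Fin n → Bool} {S : Fin m → Fin m → Bool} (f : Fin n → Fin m) →
  (∀ {u v} → f u ≡ f v → u ≡ v) → (∀ u v → T (R u v) → T (S (f u) (f v))) →
  ∀ cs → IsCycle R cs → IsCycle S (map f cs)
map-IsCycle f f-injective hom cs (3≤∣cs∣ , u , w) =
  subst (3 ≤_) (sym (length-map f cs)) 3≤∣cs∣ ,
  Unique.map⁺ f-injective u ,
  subst (All _) (sym (cyclePairs-map f cs)) (All.map⁺ (All.map (λ {p} → hom (proj₁ p) (proj₂ p)) w))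

module Layered (N M : ℕ) where

  split : Fin (N * M) → Fin N × Fin M
  split = remQuot M

  copy : Fin (N * M) → Fin N
  copy = proj₁ ∘ split

  layer : Fin (N * M) → Fin M
  layer = proj₂ ∘ split

  split-injective : ∀ a b → layer a ≡ layer b → copy a ≡ copy b → a ≡ b
  split-injective a b e₁ e₂ =
    trans (sym (combine-remQuot {N} M a)) (trans (cong₂ combine e₂ e₁) (combine-remQuot {N} M b))

  open Compress layer public

  #within #across : List (Fin (N * M)) → ℕ
  #within vs = count (not ∘ crosses) (cyclePairs vs)
  #across vs = count crosses (cyclePairs vs)

  #within+#across≡length : ∀ vs → #within vs + #across vs ≡ length vs
  #within+#across≡length vs = trans (count-not+count crosses (cyclePairs vs)) (length-cyclePairs vs)

  #across≢1 : ∀ vs → #across vs ≢ 1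
  #across≢1 []       ()
  #across≢1 (v ∷ vs) e =
    count-crosses≡1⇒endpoints v vs v (trans (cong (count crosses) (sym (cyclePairs≡pairs∘close (v ∷ vs)))) e) refl

  #across≡0⇒#within≡length : ∀ vs → #across vs ≡ 0 → #within vs ≡ length vs
  #across≡0⇒#within≡length vs none =
    trans (sym (+-identityʳ (#within vs))) (trans (cong (#within vs +_) (sym none)) (#within+#across≡length vs))

  across⇒2≤#across : ∀ vs → #across vs ≢ 0 → 2 ≤ #across vs
  across⇒2≤#across vs some with #across vs | #across≢1 vs
  ... | 0           | _    = contradiction refl some
  ... | 1           | not1 = contradiction refl not1
  ... | suc (suc _) | _    = s≤s (s≤s z≤n)

  module _ {RV : Fin (N * M) → Fin (N * M) → Bool} {RK : Fin M → Fin M → Bool} (RK-irrefl : ∀ k → RK k k ≡ false)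
    (across-edge : ∀ a b → T (RV a b) → layer a ≢ layer b → T (RK (layer a) (layer b)))
    (across-unique : ∀ a b c d → T (RV a b) → T (RV c d) → layer a ≢ layer b → layer c ≢ layer d →
                     layer a ≡ layer d → layer b ≡ layer c → c ≡ b × d ≡ a) where

    -- Contracting the layers turns a cycle that leaves its layer into a closed walk in the quotient,
    -- which is non-backtracking because a crossing can only be undone along the same edge.
    quotient-cycle : ∀ vs → IsCycle RV vs → #across vs ≢ 0 → ∃ λ cs → IsCycle RK cs × length cs ≤ #across vs
    quotient-cycle (v ∷ vs) (3≤∣vs∣ , u , w) some = finish (nonBacktracking⇒Unique⊎cycle RK RK-irrefl W walkW nb)
      where
      closed = close (v ∷ vs)
      W = compress closed
      walk : Walk RV closed
      walk = subst (All _) (cyclePairs≡pairs∘close (v ∷ vs)) w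
      walkW : Walk RK W
      walkW = compress-walk across-edge closed walk
      length-W : length W ≡ suc (#across (v ∷ vs))
      length-W = trans (length-compress v (vs ++ v ∷ []))
                       (cong (suc ∘ count crosses) (sym (cyclePairs≡pairs∘close (v ∷ vs))))
      finish : Unique W ⊎ (∃ λ cs → IsCycle RK cs × length cs < length W) →
               ∃ λ cs → IsCycle RK cs × length cs ≤ #across (v ∷ vs)
      finish (inj₁ uW) = ⊥-elim (Unique-head≢last W (layer v)
        (proj₁ (compress-head v (vs ++ v ∷ []))) (proj₁ (compress-last (v ∷ vs) v)) uW
        (proj₂ (compress-head v (vs ++ v ∷ []))) (proj₂ (compress-last (v ∷ vs) v))
        (subst (2 ≤_) (sym length-W) (s≤s (n≢0⇒n>0 some))))
      finish (inj₂ (cs , c , lt)) = cs , c , s≤s⁻¹ (subst (length cs <_) length-W lt)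
      walk-after : ∀ P a b Q → closed ≡ P ++ a ∷ b ∷ Q → Walk RV (b ∷ Q)
      walk-after P a b Q e = Walk-tail a (b ∷ Q) (Walk-++ʳ P (a ∷ b ∷ Q) (subst (Walk RV) e walk))
      nb : NonBacktracking W
      nb P k k′ Q eq with compress-step closed P k k′ (k ∷ Q) eq
      ... | crossing P₁ a b Q₁ e₁ πa πb πa≢πb rest with compress-step (b ∷ Q₁) [] k′ k Q rest
      ... | crossing S c d R e₂ πc πd πc≢πd _
        with across-unique a b c d (Walk-step P₁ a b Q₁ (subst (Walk RV) e₁ walk))
                                   (Walk-step S c d R (subst (Walk RV) e₂ (walk-after P₁ a b Q₁ e₁)))
                                   πa≢πb πc≢πd (trans πa (sym πd)) (trans πb (sym πc))
      ... | refl , refl = close-no-reversal v vs u (s≤s⁻¹ 3≤∣vs∣) P₁ a b Q₁ S R e₁ e₂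

  Adjacency : Set
  Adjacency = Fin N × Fin M → Fin N × Fin M → Bool

  graphOn : (A : Adjacency) → (∀ p q → A p q ≡ A q p) → (∀ p → A p p ≡ false) → Graph (N * M)
  graphOn A A-sym A-irrefl = record
    { adj    = λ i j → A (split i) (split j)
    ; sym    = λ i j → A-sym (split i) (split j)
    ; irrefl = λ i → A-irrefl (split i)
    }

  degree-graphOn : ∀ A A-sym A-irrefl i →
    degree (graphOn A A-sym A-irrefl) i ≡ ∑[ u < N ] ∑[ k < M ] 𝟙 (A (split i) (u , k))
  degree-graphOn A _ _ i = begin
    sum (map f (allFin (N * M)))                   ≡⟨ sum-map-allFin f ⟩
    ∑ f                                            ≡⟨ ∑-combine {N} {M} f ⟩
    ∑[ u < N ] ∑[ k < M ] f (combine u k)          ≡⟨ sum-cong-≗ (λ u → sum-cong-≗ (λ k →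
                                                        cong (𝟙 ∘ A (split i)) (remQuot-combine u k))) ⟩
    ∑[ u < N ] ∑[ k < M ] 𝟙 (A (split i) (u , k))  ∎
    where
    open ≡-Reasoning
    f = λ j → 𝟙 (A (split i) (split j))

  inLayers : Graph N → Adjacency
  inLayers G (u , k) (v , k′) = k == k′ ∧ adj G u v

  inLayers-sym : ∀ G p q → inLayers G p q ≡ inLayers G q p
  inLayers-sym G (u , k) (v , k′) = cong₂ _∧_ (==-sym k k′) (Graph.sym G u v)

  inLayers-irrefl : ∀ G p → inLayers G p p ≡ false
  inLayers-irrefl G (u , k) = trans (cong (k == k ∧_) (irrefl G u)) (∧-zeroʳ _)

  layers : Graph N → Graph (N * M)
  layers G = graphOn (inLayers G) (inLayers-sym G) (inLayers-irrefl G)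

  degree-layers : ∀ G i → degree (layers G) i ≡ degree G (copy i)
  degree-layers G i = begin
    degree (layers G) i                                     ≡⟨ degree-graphOn (inLayers G) (inLayers-sym G) (inLayers-irrefl G) i ⟩
    ∑[ u < N ] ∑[ k < M ] 𝟙 (layer i == k ∧ adj G (copy i) u) ≡⟨ sum-cong-≗ inner ⟩
    ∑[ u < N ] 𝟙 (adj G (copy i) u)                         ≡⟨ sym (sum-map-allFin (𝟙 ∘ adj G (copy i))) ⟩
    degree G (copy i)                                       ∎
    where
    open ≡-Reasoning
    inner : ∀ u → ∑[ k < M ] 𝟙 (layer i == k ∧ adj G (copy i) u) ≡ 𝟙 (adj G (copy i) u)
    inner u = begin
      ∑[ k < M ] 𝟙 (layer i == k ∧ adj G (copy i) u)    ≡⟨ sum-cong-≗ (λ k → 𝟙-∧ (layer i == k) _) ⟩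
      ∑[ k < M ] (𝟙 (layer i == k) * 𝟙 (adj G (copy i) u)) ≡⟨ sym (*-distribʳ-sum (𝟙 (adj G (copy i) u)) (λ k → 𝟙 (layer i == k))) ⟩
      (∑[ k < M ] 𝟙 (layer i == k)) * 𝟙 (adj G (copy i) u) ≡⟨ cong (_* 𝟙 (adj G (copy i) u)) (∑-𝟙-== (layer i)) ⟩
      1 * 𝟙 (adj G (copy i) u)                           ≡⟨ *-identityˡ _ ⟩
      𝟙 (adj G (copy i) u)                               ∎

  layers-regular : ∀ {r} G → Regular r G → Regular r (layers G)
  layers-regular G G-regular i = trans (degree-layers G i) (G-regular (copy i))

  inLayers-within : ∀ G a b → layer a ≡ layer b → adj (layers G) a b ≡ adj G (copy a) (copy b)
  inLayers-within G a b e = cong (_∧ adj G (copy a) (copy b)) (trans (cong (layer a ==_) (sym e)) (==-refl (layer a)))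

  inLayers-across : ∀ G a b → layer a ≢ layer b → adj (layers G) a b ≡ false
  inLayers-across G a b ne = cong (_∧ adj G (copy a) (copy b)) (==-false ne)

  module Bridges (R : Adjacency) (R-sym : ∀ p q → R p q ≡ R q p)
                 (R-across : ∀ p q → T (R p q) → proj₂ p ≢ proj₂ q) where

    R-within : ∀ p q → proj₂ p ≡ proj₂ q → R p q ≡ false
    R-within p q e with R p q in eq
    ... | true  = contradiction e (R-across p q (Equivalence.from T-≡ eq))
    ... | false = refl

    R-irrefl : ∀ p → R p p ≡ false
    R-irrefl p = R-within p p refl

    bridges : Graph (N * M)
    bridges = graphOn R R-sym R-irrefl

    lightLayers heavyLayers : Graph N → WGraph (N * M)
    lightLayers G = record
      { L = layers G ; H = bridges
      ; disjoint = λ a b e → R-within (split a) (split b)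
          (==⇒≡ (proj₁ (Equivalence.to T-∧ (Equivalence.from T-≡ e)))) }
    heavyLayers G = record
      { L = bridges ; H = layers G
      ; disjoint = λ a b e → inLayers-across G a b (R-across (split a) (split b) (Equivalence.from T-≡ e)) }

    record IsLayered (G : Graph N) (W : WGraph (N * M)) (w-within w-across : ℕ) : Set where
      field
        within  : ∀ a b → T (wadj W a b) → layer a ≡ layer b → T (adj G (copy a) (copy b))
        across  : ∀ a b → T (wadj W a b) → layer a ≢ layer b → T (R (split a) (split b))
        weight  : ∀ a b → T (wadj W a b) → edgeWeight W (a , b) ≡ (if crosses (a , b) then w-across else w-within)
        layers⊆ : ∀ a b → T (adj (layers G) a b) → T (wadj W a b)

    lightLayers-isLayered : ∀ G → IsLayered G (lightLayers G) 1 2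
    lightLayers-isLayered G = record
      { within = within ; across = across ; weight = weight ; layers⊆ = λ a b → Equivalence.from T-∨ ∘ inj₁ }
      where
      W = lightLayers G
      within : ∀ a b → T (wadj W a b) → layer a ≡ layer b → T (adj G (copy a) (copy b))
      within a b t e = subst T (inLayers-within G a b e) (T-∨-resolveʳ t (R-within (split a) (split b) e))
      across : ∀ a b → T (wadj W a b) → layer a ≢ layer b → T (R (split a) (split b))
      across a b t ne = T-∨-resolveˡ t (inLayers-across G a b ne)
      weight : ∀ a b → T (wadj W a b) → edgeWeight W (a , b) ≡ (if crosses (a , b) then 2 else 1)
      weight a b t with within a b t | across a b t | layer a F.≟ layer b
      ... | within-ab | _ | yes e = cong (λ x → if x then 1 else (if R (split a) (split b) then 2 else 0))
                                         (Equivalence.to T-≡ (within-ab e))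
      ... | _ | across-ab | no ne = cong (λ x → if x then 2 else 0) (Equivalence.to T-≡ (across-ab ne))

    heavyLayers-isLayered : ∀ G → IsLayered G (heavyLayers G) 2 1
    heavyLayers-isLayered G = record
      { within = within ; across = across ; weight = weight ; layers⊆ = λ a b → Equivalence.from T-∨ ∘ inj₂ }
      where
      W = heavyLayers G
      within : ∀ a b → T (wadj W a b) → layer a ≡ layer b → T (adj G (copy a) (copy b))
      within a b t e = subst T (inLayers-within G a b e) (T-∨-resolveˡ t (R-within (split a) (split b) e))
      across : ∀ a b → T (wadj W a b) → layer a ≢ layer b → T (R (split a) (split b))
      across a b t ne = T-∨-resolveʳ t (inLayers-across G a b ne)
      weight : ∀ a b → T (wadj W a b) → edgeWeight W (a , b) ≡ (if crosses (a , b) then 1 else 2)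
      weight a b t with within a b t | across a b t | layer a F.≟ layer b
      ... | within-ab | _ | yes e = trans (cong (λ x → if x then 1 else (if adj G (copy a) (copy b) then 2 else 0))
                                                (R-within (split a) (split b) e))
                                          (cong (λ x → if x then 2 else 0) (Equivalence.to T-≡ (within-ab e)))
      ... | _ | across-ab | no ne = cong (λ x → if x then 1 else (if false then 2 else 0))
                                         (Equivalence.to T-≡ (across-ab ne))

    module LayeredCycles {G W w-within w-across} (isLayered : IsLayered G W w-within w-across) where
      open IsLayered isLayered

      cycleWeight-layered : ∀ vs → IsCycle (wadj W) vs →
        cycleWeight W vs ≡ w-within * #within vs + w-across * #across vs
      cycleWeight-layered vs (_ , _ , w) = sum-map-if (edgeWeight W) crosses w-within w-across (cyclePairs vs)
        (All.map (λ {p} → weight (proj₁ p) (proj₂ p)) w)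

      cycleWeight-within : ∀ vs → IsCycle (wadj W) vs → #across vs ≡ 0 → cycleWeight W vs ≡ w-within * length vs
      cycleWeight-within vs c none = begin
        cycleWeight W vs                             ≡⟨ cycleWeight-layered vs c ⟩
        w-within * #within vs + w-across * #across vs ≡⟨ cong (λ n → w-within * #within vs + w-across * n) none ⟩
        w-within * #within vs + w-across * 0         ≡⟨ cong (w-within * #within vs +_) (*-zeroʳ w-across) ⟩
        w-within * #within vs + 0                    ≡⟨ +-identityʳ _ ⟩
        w-within * #within vs                        ≡⟨ cong (w-within *_) (#across≡0⇒#within≡length vs none) ⟩
        w-within * length vs                         ∎
        where open ≡-Reasoning

      w-across*#across≤cycleWeight : ∀ vs → IsCycle (wadj W) vs → w-across * #across vs ≤ cycleWeight W vs
      w-across*#across≤cycleWeight vs c =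
        subst (w-across * #across vs ≤_) (sym (cycleWeight-layered vs c)) (m≤n+m _ (w-within * #within vs))

      Unique-map-copy : ∀ k xs → All (λ x → layer x ≡ k) xs → Unique xs → Unique (map copy xs)
      Unique-map-copy k []       _          _        = []
      Unique-map-copy k (x ∷ xs) (kx ∷ kxs) (x∉ ∷ u) =
        All.map⁺ (All.zipWith (λ { {y} (x≢y , ky) → x≢y ∘ split-injective x y (trans kx (sym ky)) }) (x∉ , kxs))
        ∷ Unique-map-copy k xs kxs u

      copy-IsCycle : ∀ vs → IsCycle (wadj W) vs → #across vs ≡ 0 → IsCycle (adj G) (map copy vs)
      copy-IsCycle (v ∷ vs) (3≤∣vs∣ , u , w) none =
        subst (3 ≤_) (sym (length-map copy (v ∷ vs))) 3≤∣vs∣ ,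
        Unique-map-copy (layer v) (v ∷ vs) (All.++⁻ˡ (v ∷ vs) sameLayer) u ,
        subst (All _) (sym (cyclePairs-map copy (v ∷ vs)))
          (All.map⁺ (All.zipWith (λ {p} (t , e) → within (proj₁ p) (proj₂ p) t e)
                                 (w , count-crosses≡0⇒All (cyclePairs (v ∷ vs)) none)))
        where
        sameLayer = count-crosses≡0⇒sameLayer v (vs ++ v ∷ [])
                      (trans (cong (count crosses) (sym (cyclePairs≡pairs∘close (v ∷ vs)))) none)

      layer-IsCycle : ∀ k cs → IsCycle (adj G) cs →
        IsCycle (wadj W) (map (λ u → combine u k) cs) × cycleWeight W (map (λ u → combine u k) cs) ≡ w-within * length cs
      layer-IsCycle k cs c@(_ , _ , w) = map-IsCycle into (combine-injectiveˡ _ k _ k) hom cs c , (begin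
        cycleWeight W (map into cs)                   ≡⟨ sum-map-const (edgeWeight W) w-within _ (subst (All _)
                                                           (sym (cyclePairs-map into cs))
                                                           (All.map⁺ (All.map (λ {p} → edge-within (proj₁ p) (proj₂ p)) w))) ⟩
        w-within * length (cyclePairs (map into cs))  ≡⟨ cong (w-within *_) (length-cyclePairs (map into cs)) ⟩
        w-within * length (map into cs)               ≡⟨ cong (w-within *_) (length-map into cs) ⟩
        w-within * length cs                          ∎)
        where
        open ≡-Reasoning
        into : Fin N → Fin (N * M)
        into u = combine u k
        layer-into : ∀ u → layer (into u) ≡ k
        layer-into u = cong proj₂ (remQuot-combine u k)
        hom : ∀ u v → T (adj G u v) → T (wadj W (into u) (into v))
        hom u v t = layers⊆ (into u) (into v) (subst T (sym (trans (cong₂ (inLayers G) (remQuot-combine u k) (remQuot-combine v k))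
                                                               (cong (_∧ adj G u v) (==-refl k)))) t)
        edge-within : ∀ u v → T (adj G u v) → edgeWeight W (into u , into v) ≡ w-within
        edge-within u v t = trans (weight (into u) (into v) (hom u v t))
          (cong (λ x → if not x then w-across else w-within)
                (trans (cong₂ _==_ (layer-into u) (layer-into v)) (==-refl k)))

-- Bounds (1) and (2): the edges of K dealt out to the copies

module Spread {N′ M : ℕ} (K : Graph M) (c : ℕ) (K-regular : Regular (c * suc N′) K) where
  N = suc N′
  open Layered N M

  -- Copy u of k is joined towards the neighbours of k whose rank among them is u modulo N;
  -- as k has c · N neighbours, every copy gets exactly c of them.
  slot : Fin M → Fin M → ℕ
  slot k k′ = rank (adj K k) k′ % N

  spread : Adjacency
  spread (u , k) (v , k′) = adj K k k′ ∧ ((toℕ u ≡ᵇ slot k k′) ∧ (toℕ v ≡ᵇ slot k′ k))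

  spread-sym : ∀ p q → spread p q ≡ spread q p
  spread-sym (u , k) (v , k′) = cong₂ _∧_ (Graph.sym K k k′) (∧-comm (toℕ u ≡ᵇ slot k k′) (toℕ v ≡ᵇ slot k′ k))

  spread⇒ : ∀ u k v k′ → T (spread (u , k) (v , k′)) → T (adj K k k′) × toℕ u ≡ slot k k′ × toℕ v ≡ slot k′ k
  spread⇒ u k v k′ t with Equivalence.to T-∧ t
  ... | kk′ , t′ with Equivalence.to T-∧ t′
  ... | tu , tv = kk′ , ≡ᵇ⇒≡ _ _ tu , ≡ᵇ⇒≡ _ _ tv

  spread-across : ∀ p q → T (spread p q) → proj₂ p ≢ proj₂ q
  spread-across (u , k) (v , k′) t refl = subst T (irrefl K k) (proj₁ (spread⇒ u k v k′ t))

  open Bridges spread spread-sym spread-across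

  degree-bridges : Regular c bridges
  degree-bridges i = begin
    degree bridges i                                          ≡⟨ degree-graphOn spread spread-sym R-irrefl i ⟩
    ∑[ u < N ] ∑[ k < M ] 𝟙 (spread (u₀ , k₀) (u , k))        ≡⟨ ∑-comm (λ u k → 𝟙 (spread (u₀ , k₀) (u , k))) ⟩
    ∑[ k < M ] ∑[ u < N ] 𝟙 (spread (u₀ , k₀) (u , k))        ≡⟨ sum-cong-≗ one-copy ⟩
    ∑[ k < M ] 𝟙 (adj K k₀ k ∧ P (rank (adj K k₀) k))         ≡⟨ ∑-rank (adj K k₀) P 0 ⟩
    countFrom P 0 (∑ (𝟙 ∘ adj K k₀))                         ≡⟨ cong (countFrom P 0) (sym (sum-map-allFin (𝟙 ∘ adj K k₀))) ⟩
    countFrom P 0 (degree K k₀)                               ≡⟨ cong (countFrom P 0) (K-regular k₀) ⟩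
    countFrom P 0 (c * N)                                     ≡⟨ countFrom-residue N c (toℕ u₀) (toℕ<n u₀) ⟩
    c                                                         ∎
    where
    open ≡-Reasoning
    u₀ = copy i
    k₀ = layer i
    P = λ r → toℕ u₀ ≡ᵇ r % N
    one-copy : ∀ k → ∑[ u < N ] 𝟙 (spread (u₀ , k₀) (u , k)) ≡ 𝟙 (adj K k₀ k ∧ P (rank (adj K k₀) k))
    one-copy k = begin
      ∑[ u < N ] 𝟙 (x ∧ (y ∧ z u))      ≡⟨ sum-cong-≗ (λ u → trans (cong 𝟙 (sym (∧-assoc x y (z u)))) (𝟙-∧ (x ∧ y) (z u))) ⟩
      ∑[ u < N ] (𝟙 (x ∧ y) * 𝟙 (z u)) ≡⟨ sym (*-distribˡ-sum (𝟙 (x ∧ y)) (𝟙 ∘ z)) ⟩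
      𝟙 (x ∧ y) * ∑[ u < N ] 𝟙 (z u)   ≡⟨ cong (𝟙 (x ∧ y) *_) (∑-𝟙-toℕ≡ᵇ (slot k k₀) (m%n<n (rank (adj K k) k₀) N)) ⟩
      𝟙 (x ∧ y) * 1                     ≡⟨ *-identityʳ _ ⟩
      𝟙 (x ∧ y)                         ∎
      where
      x = adj K k₀ k
      y = toℕ u₀ ≡ᵇ slot k₀ k
      z = λ u → toℕ u ≡ᵇ slot k k₀

  module _ {G W w-within w-across} (isLayered : IsLayered G W w-within w-across) where
    open IsLayered isLayered
    open LayeredCycles isLayered

    across-edge : ∀ a b → T (wadj W a b) → layer a ≢ layer b → T (adj K (layer a) (layer b))
    across-edge a b t ne = proj₁ (spread⇒ (copy a) (layer a) (copy b) (layer b) (across a b t ne))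

    across-unique : ∀ a b c d → T (wadj W a b) → T (wadj W c d) → layer a ≢ layer b → layer c ≢ layer d →
                    layer a ≡ layer d → layer b ≡ layer c → c ≡ b × d ≡ a
    across-unique a b c d tab tcd ab cd ad bc
      with spread⇒ _ _ _ _ (across a b tab ab) | spread⇒ _ _ _ _ (across c d tcd cd)
    ... | _ , slot-a , slot-b | _ , slot-c , slot-d =
      split-injective c b (sym bc) (toℕ-injective (trans slot-c (trans (cong₂ slot (sym bc) (sym ad)) (sym slot-b)))) ,
      split-injective d a (sym ad) (toℕ-injective (trans slot-d (trans (cong₂ slot (sym ad) (sym bc)) (sym slot-a))))

    girth-spread : ∀ g → (∀ cs → IsCycle (adj G) cs → g ≤ w-within * length cs) →
                         (∀ cs → IsCycle (adj K) cs → g ≤ w-across * length cs) →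
                         ∀ vs → IsCycle (wadj W) vs → g ≤ cycleWeight W vs
    girth-spread g G-girth K-girth vs c with #across vs ≟ 0
    ... | yes none = begin
      g                             ≤⟨ G-girth (map copy vs) (copy-IsCycle vs c none) ⟩
      w-within * length (map copy vs) ≡⟨ cong (w-within *_) (length-map copy vs) ⟩
      w-within * length vs          ≡⟨ sym (cycleWeight-within vs c none) ⟩
      cycleWeight W vs              ∎
      where open ≤-Reasoning
    ... | no some with quotient-cycle (irrefl K) across-edge across-unique vs c some
    ... | cs , cs-cycle , ∣cs∣≤#across = begin
      g                             ≤⟨ K-girth cs cs-cycle ⟩
      w-across * length cs          ≤⟨ *-monoʳ-≤ w-across ∣cs∣≤#across ⟩
      w-across * #across vs         ≤⟨ w-across*#across≤cycleWeight vs c ⟩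
      cycleWeight W vs              ∎
      where open ≤-Reasoning

  spread-light : ∀ {a g} (G : Graph N) → Regular a G → HasGirth G g →
    (∀ cs → IsCycle (adj K) cs → g ≤ 2 * length cs) → Fin M → HasWGraph a c g (N * M)
  spread-light {g = g} G G-regular ((cs , cs-cycle , ∣cs∣≡g) , G-girth) K-girth k₀ =
    lightLayers G , layers-regular G G-regular , degree-bridges ,
    (map (λ u → combine u k₀) cs , proj₁ witness , trans (proj₂ witness) (trans (*-identityˡ _) ∣cs∣≡g)) ,
    girth-spread isLayered g (λ cs c → subst (g ≤_) (sym (*-identityˡ _)) (G-girth cs c)) K-girth
    where
    isLayered = lightLayers-isLayered G
    witness = LayeredCycles.layer-IsCycle isLayered k₀ cs cs-cycle

  spread-heavy : ∀ {b g} (G : Graph N) → Regular b G → (∃ λ cs → IsCycle (adj G) cs × 2 * length cs ≡ g) →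
    (∀ cs → IsCycle (adj G) cs → g ≤ 2 * length cs) → (∀ cs → IsCycle (adj K) cs → g ≤ length cs) →
    Fin M → HasWGraph c b g (N * M)
  spread-heavy {g = g} G G-regular (cs , cs-cycle , 2∣cs∣≡g) G-girth K-girth k₀ =
    heavyLayers G , degree-bridges , layers-regular G G-regular ,
    (map (λ u → combine u k₀) cs , proj₁ witness , trans (proj₂ witness) 2∣cs∣≡g) ,
    girth-spread isLayered g G-girth (λ cs c → subst (g ≤_) (sym (*-identityˡ _)) (K-girth cs c))
    where
    isLayered = heavyLayers-isLayered G
    witness = LayeredCycles.layer-IsCycle isLayered k₀ cs cs-cycle

-- Bounds (3) and (4): two layers joined by a perfect matching

2+n≰1 : ∀ {n} → ¬ 2 + n ≤ 1
2+n≰1 (s≤s ())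

Fin2-≢-≢⇒≡ : ∀ (i j k : Fin 2) → i ≢ j → j ≢ k → i ≡ k
Fin2-≢-≢⇒≡ zero       zero       _          i≢j _   = contradiction refl i≢j
Fin2-≢-≢⇒≡ zero       (suc zero) zero       _   _   = refl
Fin2-≢-≢⇒≡ zero       (suc zero) (suc zero) _   j≢k = contradiction refl j≢k
Fin2-≢-≢⇒≡ (suc zero) zero       zero       _   j≢k = contradiction refl j≢k
Fin2-≢-≢⇒≡ (suc zero) zero       (suc zero) _   _   = refl
Fin2-≢-≢⇒≡ (suc zero) (suc zero) _          i≢j _   = contradiction refl i≢j

module Doubled (N : ℕ) where
  open Layered N 2

  matching : Adjacency
  matching (u , k) (v , k′) = not (k == k′) ∧ (u == v)

  matching-sym : ∀ p q → matching p q ≡ matching q p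
  matching-sym (u , k) (v , k′) = cong₂ _∧_ (cong not (==-sym k k′)) (==-sym u v)

  matching-across : ∀ p q → T (matching p q) → proj₂ p ≢ proj₂ q
  matching-across (u , k) (v , k′) t refl = subst T (cong (λ x → not x ∧ (u == v)) (==-refl k)) t

  open Bridges matching matching-sym matching-across public

  degree-bridges : Regular 1 bridges
  degree-bridges i = begin
    degree bridges i                                               ≡⟨ degree-graphOn matching matching-sym R-irrefl i ⟩
    ∑[ u < N ] ∑[ k < 2 ] 𝟙 (not (layer i == k) ∧ (copy i == u))  ≡⟨ sum-cong-≗ other-layer ⟩
    ∑[ u < N ] 𝟙 (copy i == u)                                     ≡⟨ ∑-𝟙-== (copy i) ⟩
    1                                                              ∎
    where
    open ≡-Reasoning
    one-other : ∀ (k : Fin 2) → ∑[ k′ < 2 ] 𝟙 (not (k == k′)) ≡ 1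
    one-other zero       = refl
    one-other (suc zero) = refl
    other-layer : ∀ u → ∑[ k < 2 ] 𝟙 (not (layer i == k) ∧ (copy i == u)) ≡ 𝟙 (copy i == u)
    other-layer u = begin
      ∑[ k < 2 ] 𝟙 (not (layer i == k) ∧ x)          ≡⟨ sum-cong-≗ (λ k → 𝟙-∧ (not (layer i == k)) x) ⟩
      ∑[ k < 2 ] (𝟙 (not (layer i == k)) * 𝟙 x)      ≡⟨ sym (*-distribʳ-sum (𝟙 x) (λ k → 𝟙 (not (layer i == k)))) ⟩
      (∑[ k < 2 ] 𝟙 (not (layer i == k))) * 𝟙 x      ≡⟨ cong (_* 𝟙 x) (one-other (layer i)) ⟩
      1 * 𝟙 x                                        ≡⟨ *-identityˡ _ ⟩
      𝟙 x                                            ∎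
      where x = copy i == u

  module _ {G W w-within w-across} (isLayered : IsLayered G W w-within w-across) where
    open IsLayered isLayered
    open LayeredCycles isLayered

    across-copy : ∀ a b → T (wadj W a b) → layer a ≢ layer b → copy a ≡ copy b
    across-copy a b t ne = ==⇒≡ (proj₂ (Equivalence.to T-∧ (across a b t ne)))

    two-crossings : ∀ a b c → T (wadj W a b) → T (wadj W b c) → layer a ≢ layer b → layer b ≢ layer c → a ≡ c
    two-crossings a b c tab tbc ab bc = split-injective a c (Fin2-≢-≢⇒≡ (layer a) (layer b) (layer c) ab bc)
                                                            (trans (across-copy a b tab ab) (across-copy b c tbc bc))

    triangle-within : ∀ x y z → IsCycle (wadj W) (x ∷ y ∷ z ∷ []) → #across (x ∷ y ∷ z ∷ []) ≡ 0
    triangle-within x y z (_ , (x≢y ∷ x≢z ∷ []) ∷ (y≢z ∷ []) ∷ [] ∷ [] , txy ∷ tyz ∷ tzx ∷ [])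
      with layer x F.≟ layer y | layer y F.≟ layer z | layer z F.≟ layer x
    ... | yes _ | yes _ | yes _ = refl
    ... | yes p | yes q | no r  = contradiction (sym (trans p q)) r
    ... | yes p | no q  | yes r = contradiction (sym (trans r p)) q
    ... | no p  | yes q | yes r = contradiction (sym (trans q r)) p
    ... | no p  | no q  | _     = contradiction (two-crossings x y z txy tyz p q) x≢z
    ... | _     | no q  | no r  = contradiction (sym (two-crossings y z x tyz tzx q r)) x≢y
    ... | no p  | _     | no r  = contradiction (sym (two-crossings z x y tzx txy r p)) y≢z

    across⇒4≤length : ∀ vs → IsCycle (wadj W) vs → #across vs ≢ 0 → 4 ≤ length vs
    across⇒4≤length (x ∷ y ∷ z ∷ [])        c     some = contradiction (triangle-within x y z c) some
    across⇒4≤length (_ ∷ _ ∷ _ ∷ _ ∷ _)     _     _    = s≤s (s≤s (s≤s (s≤s z≤n)))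
    across⇒4≤length []                      (() , _) _
    across⇒4≤length (_ ∷ [])                (s≤s () , _) _
    across⇒4≤length (_ ∷ _ ∷ [])            (s≤s (s≤s ()) , _) _

    few-within⇒backtrack : ∀ x₀ x₁ x₂ x₃ x₄ xs → Walk (wadj W) (x₀ ∷ x₁ ∷ x₂ ∷ x₃ ∷ x₄ ∷ xs) →
      count (not ∘ crosses) (pairs (x₀ ∷ x₁ ∷ x₂ ∷ x₃ ∷ x₄ ∷ xs)) ≤ 1 →
      ¬ NonBacktracking (x₀ ∷ x₁ ∷ x₂ ∷ x₃ ∷ x₄ ∷ xs)
    few-within⇒backtrack x₀ x₁ x₂ x₃ x₄ xs (t₀₁ ∷ t₁₂ ∷ t₂₃ ∷ t₃₄ ∷ _) ≤1 nb
      with layer x₀ F.≟ layer x₁ | layer x₁ F.≟ layer x₂ | layer x₂ F.≟ layer x₃ | layer x₃ F.≟ layer x₄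
    ... | no p  | no q  | _     | _     =
      nb [] x₀ x₁ (x₃ ∷ x₄ ∷ xs) (cong (λ z → x₀ ∷ x₁ ∷ z ∷ x₃ ∷ x₄ ∷ xs) (sym (two-crossings x₀ x₁ x₂ t₀₁ t₁₂ p q)))
    ... | _     | _     | no p  | no q  =
      nb (x₀ ∷ x₁ ∷ []) x₂ x₃ xs (cong (λ z → x₀ ∷ x₁ ∷ x₂ ∷ x₃ ∷ z ∷ xs) (sym (two-crossings x₂ x₃ x₄ t₂₃ t₃₄ p q)))
    ... | yes _ | yes _ | yes _ | _     = 2+n≰1 ≤1
    ... | yes _ | yes _ | no _  | yes _ = 2+n≰1 ≤1
    ... | yes _ | no _  | yes _ | _     = 2+n≰1 ≤1
    ... | yes _ | no _  | no _  | yes _ = 2+n≰1 ≤1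
    ... | no _  | yes _ | yes _ | _     = 2+n≰1 ≤1
    ... | no _  | yes _ | no _  | yes _ = 2+n≰1 ≤1

    4≤length⇒2≤#within : ∀ vs → IsCycle (wadj W) vs → 4 ≤ length vs → 2 ≤ #within vs
    4≤length⇒2≤#within []                  _ ()
    4≤length⇒2≤#within (_ ∷ [])            _ (s≤s ())
    4≤length⇒2≤#within (_ ∷ _ ∷ [])        _ (s≤s (s≤s ()))
    4≤length⇒2≤#within (_ ∷ _ ∷ _ ∷ [])    _ (s≤s (s≤s (s≤s ())))
    4≤length⇒2≤#within vs@(v ∷ a₁ ∷ a₂ ∷ a₃ ∷ rest) (_ , u , w) _ with 2 ≤? #within vs | ∷ʳ≡∷ rest v
    ... | yes 2≤#within | _            = 2≤#within
    ... | no  2≰#within | a₄ , xs , eq = ⊥-elim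
      (few-within⇒backtrack v a₁ a₂ a₃ a₄ xs (subst (Walk (wadj W)) closed walk)
        (subst (λ ws → count (not ∘ crosses) (pairs ws) ≤ 1) closed
          (subst (λ ps → count (not ∘ crosses) ps ≤ 1) (cyclePairs≡pairs∘close vs) (s≤s⁻¹ (≰⇒> 2≰#within))))
        (subst NonBacktracking closed (close-nonBacktracking v (a₁ ∷ a₂ ∷ a₃ ∷ rest) u (s≤s (s≤s z≤n)))))
      where
      closed : close vs ≡ v ∷ a₁ ∷ a₂ ∷ a₃ ∷ a₄ ∷ xs
      closed = cong (λ ys → v ∷ a₁ ∷ a₂ ∷ a₃ ∷ ys) eq
      walk : Walk (wadj W) (close vs)
      walk = subst (All _) (cyclePairs≡pairs∘close vs) w

  doubled-light : ∀ {a g} (G : Graph N) → Regular a G → HasGirth G g → g ≤ 6 → HasWGraph a 1 g (N * 2)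
  doubled-light {g = g} G G-regular ((cs , cs-cycle , ∣cs∣≡g) , G-girth) g≤6 =
    W , layers-regular G G-regular , degree-bridges ,
    (map (λ u → combine u zero) cs , proj₁ witness , trans (proj₂ witness) (trans (*-identityˡ _) ∣cs∣≡g)) , girth
    where
    W = lightLayers G
    isLayered = lightLayers-isLayered G
    open LayeredCycles isLayered
    witness = layer-IsCycle zero cs cs-cycle
    girth : ∀ vs → IsCycle (wadj W) vs → g ≤ cycleWeight W vs
    girth vs c with #across vs ≟ 0
    ... | yes none = begin
      g                                    ≤⟨ G-girth (map copy vs) (copy-IsCycle vs c none) ⟩
      length (map copy vs)                 ≡⟨ length-map copy vs ⟩
      length vs                            ≡⟨ sym (*-identityˡ _) ⟩
      1 * length vs                        ≡⟨ sym (cycleWeight-within vs c none) ⟩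
      cycleWeight W vs                     ∎
      where open ≤-Reasoning
    ... | no some = begin
      g                                    ≤⟨ g≤6 ⟩
      4 + 2                                ≤⟨ +-mono-≤ (across⇒4≤length isLayered vs c some) (across⇒2≤#across vs some) ⟩
      length vs + #across vs               ≡⟨ cong (_+ #across vs) (sym (#within+#across≡length vs)) ⟩
      #within vs + #across vs + #across vs ≡⟨ solve 2 (λ x y → x :+ y :+ y := con 1 :* x :+ con 2 :* y) refl
                                                      (#within vs) (#across vs) ⟩
      1 * #within vs + 2 * #across vs      ≡⟨ sym (cycleWeight-layered vs c) ⟩
      cycleWeight W vs                     ∎
      where
      open ≤-Reasoning
      open +-*-Solver

  doubled-heavy : ∀ {b} (G : Graph N) → Regular b G →
    (∃ λ vs → IsCycle (wadj (heavyLayers G)) vs × cycleWeight (heavyLayers G) vs ≡ 6) → HasWGraph 1 b 6 (N * 2)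
  doubled-heavy G G-regular witness = W , degree-bridges , layers-regular G G-regular , witness , girth
    where
    W = heavyLayers G
    isLayered = heavyLayers-isLayered G
    open LayeredCycles isLayered
    girth : ∀ vs → IsCycle (wadj W) vs → 6 ≤ cycleWeight W vs
    girth vs c with #across vs ≟ 0
    ... | yes none = begin
      2 * 3                                ≤⟨ *-monoʳ-≤ 2 (proj₁ c) ⟩
      2 * length vs                        ≡⟨ sym (cycleWeight-within vs c none) ⟩
      cycleWeight W vs                     ∎
      where open ≤-Reasoning
    ... | no some = begin
      4 + 2                                ≤⟨ +-mono-≤ 4≤∣vs∣ (4≤length⇒2≤#within isLayered vs c 4≤∣vs∣) ⟩
      length vs + #within vs               ≡⟨ cong (_+ #within vs) (sym (#within+#across≡length vs)) ⟩
      #within vs + #across vs + #within vs ≡⟨ solve 2 (λ x y → x :+ y :+ x := con 2 :* x :+ con 1 :* y) refl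
                                                      (#within vs) (#across vs) ⟩
      2 * #within vs + 1 * #across vs      ≡⟨ sym (cycleWeight-layered vs c) ⟩
      cycleWeight W vs                     ∎
      where
      open ≤-Reasoning
      open +-*-Solver
      4≤∣vs∣ = across⇒4≤length isLayered vs c some

  triangle-witness : ∀ (G : Graph N) cs → IsCycle (adj G) cs → length cs ≡ 3 →
    ∃ λ vs → IsCycle (wadj (heavyLayers G)) vs × cycleWeight (heavyLayers G) vs ≡ 6
  triangle-witness G cs c ∣cs∣≡3 =
    map (λ u → combine u zero) cs , proj₁ witness , trans (proj₂ witness) (cong (2 *_) ∣cs∣≡3)
    where witness = LayeredCycles.layer-IsCycle (heavyLayers-isLayered G) zero cs c

-- The four bounds

complete : ∀ r → Graph (suc r)
complete r = record
  { adj    = λ i j → not (i == j)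
  ; sym    = λ i j → cong not (==-sym i j)
  ; irrefl = λ i → cong not (==-refl i)
  }

complete-regular : ∀ r → Regular r (complete r)
complete-regular r i = suc-injective (begin
  suc (degree (complete r) i)                 ≡⟨ +-comm 1 _ ⟩
  degree (complete r) i + 1                   ≡⟨ cong₂ _+_ (sum-map-allFin (𝟙 ∘ not ∘ (i ==_))) (sym (∑-𝟙-== i)) ⟩
  ∑ (𝟙 ∘ not ∘ (i ==_)) + ∑ (𝟙 ∘ (i ==_))     ≡⟨ ∑-𝟙-not+∑-𝟙 (i ==_) ⟩
  suc r                                       ∎)
  where open ≡-Reasoning

no-cycle-≤2 : ∀ {r} → r ≤ 1 → ∀ {R : Fin (suc r) → Fin (suc r) → Bool} vs → ¬ IsCycle R vs
no-cycle-≤2 r≤1 (x ∷ y ∷ z ∷ _) (_ , (x≢y ∷ x≢z ∷ _) ∷ (y≢z ∷ _) ∷ _ , _) = x≢z (x≡z r≤1 x y z x≢y y≢z)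
  where
  x≡z : ∀ {r} → r ≤ 1 → (x y z : Fin (suc r)) → x ≢ y → y ≢ z → x ≡ z
  x≡z z≤n       zero zero _ x≢y _ = contradiction refl x≢y
  x≡z (s≤s z≤n) x    y    z       = Fin2-≢-≢⇒≡ x y z
no-cycle-≤2 _ []          (() , _)
no-cycle-≤2 _ (_ ∷ [])     (s≤s () , _)
no-cycle-≤2 _ (_ ∷ _ ∷ []) (s≤s (s≤s ()) , _)

girth-vertex : ∀ {n} {G : Graph n} {g} → HasGirth G g → Fin n
girth-vertex ((v ∷ _ , _) , _)       = v
girth-vertex (([] , () , _) , _)

g≤2*⌈g/2⌉ : ∀ g → g ≤ 2 * ⌈ g /2⌉
g≤2*⌈g/2⌉ g = begin
  g                              ≡⟨ sym (⌊n/2⌋+⌈n/2⌉≡n g) ⟩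
  ⌊ g /2⌋ + ⌈ g /2⌉              ≤⟨ +-monoˡ-≤ ⌈ g /2⌉ (⌊n/2⌋≤⌈n/2⌉ g) ⟩
  ⌈ g /2⌉ + ⌈ g /2⌉              ≡⟨ cong (⌈ g /2⌉ +_) (sym (+-identityʳ ⌈ g /2⌉)) ⟩
  2 * ⌈ g /2⌉                    ∎
  where open ≤-Reasoning

⌈g/2⌉≡2⇒g≤4 : ∀ g → ⌈ g /2⌉ ≡ 2 → g ≤ 4
⌈g/2⌉≡2⇒g≤4 g e = begin
  g            ≤⟨ g≤2*⌈g/2⌉ g ⟩
  2 * ⌈ g /2⌉  ≡⟨ cong (2 *_) e ⟩
  4            ∎
  where open ≤-Reasoning

2*⌊g/2⌋≡g : ∀ g → 2 ∣ g → 2 * ⌊ g /2⌋ ≡ g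
2*⌊g/2⌋≡g g (divides q refl) = trans (cong (2 *_) (⌊q*2/2⌋≡q q)) (*-comm 2 q)
  where
  ⌊q*2/2⌋≡q : ∀ q → ⌊ q * 2 /2⌋ ≡ q
  ⌊q*2/2⌋≡q zero    = refl
  ⌊q*2/2⌋≡q (suc q) = cong suc (⌊q*2/2⌋≡q q)

NWLe-spread-light : ∀ a b g N M → a ≥ 2 → g ≥ 3 →
  IsN a g N → IsNtilde (b * N) ⌈ g /2⌉ M → NWLe a b g (N * M)
NWLe-spread-light a b g zero     M _ _ ((G , _ , G-girth) , _) _ = ⊥-elim (¬Fin0 (girth-vertex {G = G} G-girth))
NWLe-spread-light a b g (suc N′) M _ _ ((G , G-regular , G-girth) , _) ñ = suc N′ * M , ≤-refl , construct ñ
  where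
  construct : IsNtilde (b * suc N′) ⌈ g /2⌉ M → HasWGraph a b g (suc N′ * M)
  construct (inj₁ (small , refl)) =
    Spread.spread-light (complete (b * suc N′)) b (complete-regular _) G G-regular G-girth (K-girth small) zero
    where
    K-girth : b * suc N′ ≤ 1 ⊎ ⌈ g /2⌉ ≡ 2 → ∀ cs → IsCycle (adj (complete (b * suc N′))) cs → g ≤ 2 * length cs
    K-girth (inj₁ bN≤1)     cs c = contradiction c (no-cycle-≤2 bN≤1 cs)
    K-girth (inj₂ ⌈g/2⌉≡2) cs c = ≤-trans (⌈g/2⌉≡2⇒g≤4 g ⌈g/2⌉≡2) (≤-trans (m≤m+n 4 2) (*-monoʳ-≤ 2 (proj₁ c)))
  construct (inj₂ (_ , (K , K-regular , K-girth) , _)) =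
    Spread.spread-light K b K-regular G G-regular G-girth
      (λ cs c → ≤-trans (g≤2*⌈g/2⌉ g) (*-monoʳ-≤ 2 (proj₂ K-girth cs c))) (girth-vertex {G = K} K-girth)

NWLe-spread-heavy : ∀ a b g N M → b ≥ 2 → g ≥ 6 → 2 ∣ g →
  IsN b ⌊ g /2⌋ N → IsNtilde (a * N) g M → NWLe a b g (N * M)
NWLe-spread-heavy a b g zero     M _ _   _   ((G , _ , G-girth) , _) _ = ⊥-elim (¬Fin0 (girth-vertex {G = G} G-girth))
NWLe-spread-heavy a b g (suc N′) M _ g≥6 2∣g ((G , G-regular , ((cs , cs-cycle , ∣cs∣≡g/2) , G-girth)) , _) ñ =
  suc N′ * M , ≤-refl , construct ñ
  where
  witness : ∃ λ cs → IsCycle (adj G) cs × 2 * length cs ≡ g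
  witness = cs , cs-cycle , trans (cong (2 *_) ∣cs∣≡g/2) (2*⌊g/2⌋≡g g 2∣g)
  G-girth′ : ∀ vs → IsCycle (adj G) vs → g ≤ 2 * length vs
  G-girth′ vs c = subst (_≤ 2 * length vs) (2*⌊g/2⌋≡g g 2∣g) (*-monoʳ-≤ 2 (G-girth vs c))
  construct : IsNtilde (a * suc N′) g M → HasWGraph a b g (suc N′ * M)
  construct (inj₁ (inj₂ refl , _))    = contradiction g≥6 λ { (s≤s (s≤s ())) }
  construct (inj₁ (inj₁ aN≤1 , refl)) =
    Spread.spread-heavy (complete (a * suc N′)) a (complete-regular _) G G-regular witness G-girth′
      (λ cs c → contradiction c (no-cycle-≤2 aN≤1 cs)) zero
  construct (inj₂ (_ , (K , K-regular , K-girth) , _)) =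
    Spread.spread-heavy K a K-regular G G-regular witness G-girth′ (proj₂ K-girth) (girth-vertex {G = K} K-girth)

NWLe-doubled-light : ∀ a b g N → a ≥ 2 → b ≡ 1 → g ≤ 6 → IsN a g N → NWLe a b g (2 * N)
NWLe-doubled-light a .1 g N _ refl g≤6 ((G , G-regular , G-girth) , _) =
  N * 2 , ≤-reflexive (*-comm N 2) , Doubled.doubled-light N G G-regular G-girth g≤6

-- As (u , k) is numbered 2 u + k, this is the 4-cycle (0,0) (0,1) (1,1) (1,0), alternating
-- matching edges and copies of the edge of K₂.
doubled-K₂-square : ∃ λ vs → IsCycle (wadj (Doubled.heavyLayers 2 (complete 1))) vs
                          × cycleWeight (Doubled.heavyLayers 2 (complete 1)) vs ≡ 6
doubled-K₂-square =
  0F ∷ 1F ∷ 3F ∷ 2F ∷ [] ,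
  (s≤s (s≤s (s≤s z≤n)) ,
   ((λ ()) ∷ (λ ()) ∷ (λ ()) ∷ []) ∷ ((λ ()) ∷ (λ ()) ∷ []) ∷ ((λ ()) ∷ []) ∷ [] ∷ [] ,
   _ ∷ _ ∷ _ ∷ _ ∷ []) ,
  refl

NWLe-doubled-heavy : ∀ a b g M → a ≡ 1 → b ≥ 1 → g ≡ 6 → IsNtilde b 3 M → NWLe a b g (2 * M)
NWLe-doubled-heavy .1 b .6 M refl b≥1 refl (inj₁ (inj₂ () , _))
NWLe-doubled-heavy .1 b .6 M refl b≥1 refl (inj₁ (inj₁ b≤1 , refl)) =
  subst (λ b → NWLe 1 b 6 (2 * suc b)) (≤-antisym b≥1 b≤1)
    (2 * 2 , ≤-refl , Doubled.doubled-heavy 2 (complete 1) (complete-regular 1) doubled-K₂-square)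
NWLe-doubled-heavy .1 b .6 M refl b≥1 refl (inj₂ (_ , (G , G-regular , ((cs , c , ∣cs∣≡3) , _)) , _)) =
  M * 2 , ≤-reflexive (*-comm M 2) , Doubled.doubled-heavy M G G-regular (Doubled.triangle-witness M G cs c ∣cs∣≡3)

theorem9 :
    (∀ a b g N M → a ≥ 2 → g ≥ 3 →
       IsN a g N → IsNtilde (b * N) ⌈ g /2⌉ M → NWLe a b g (N * M))
    × (∀ a b g N M → b ≥ 2 → g ≥ 6 → 2 ∣ g →
       IsN b ⌊ g /2⌋ N → IsNtilde (a * N) g M → NWLe a b g (N * M))
    × (∀ a b g N → a ≥ 2 → b ≡ 1 → g ≤ 6 →
       IsN a g N → NWLe a b g (2 * N))
    × (∀ a b g M → a ≡ 1 → b ≥ 1 → g ≡ 6 →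
       IsNtilde b 3 M → NWLe a b g (2 * M))
theorem9 = NWLe-spread-light , NWLe-spread-heavy , NWLe-doubled-light , NWLe-doubled-heavy
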